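{- For every integer $n\geq 5$ with $n\equiv 1$ or $5\pmod 6$, there exists a regular SAMS$(n,2)$.
   Context: For positive integers $n,d$ with $d<n$, an $n\times n$ array $A$ with entries in $\{0,1,\dots,nd\}$ is a sparse anti-magic square of order $n$ with density $d$, denoted SAMS$(n,d)$, if each element of $\{1,2,\dots,nd\}$ occurs in exactly one entry of $A$ (all other entries being $0$), and the $n$ row-sums, $n$ column-sums and the two main diagonal sums (left diagonal: entries $(i,i)$; right diagonal: entries $(i,n+1-i)$) together form a set of $2n+2$ consecutive integers. An SAMS$(n,d)$ is regular if each row, each column and each of the two main diagonals contains exactly $d$ positive entries. -}

module Defs where

open import Data.Nat using (ℕ; zero; suc; _+_; _*_; _≤_; _<_; _≟_)
open import Data.Fin using (Fin; opposite)
open import Data.List using (List; _∷_; []; map; upTo; allFin; length; filter; _++_)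
open import Data.Nat.ListAction using (sum)
open import Data.List.Relation.Binary.Permutation.Propositional using (_↭_)
open import Data.Product using (Σ; _×_; ∃; _,_)
open import Relation.Binary.PropositionalEquality using (_≡_)
open import Relation.Nullary using (¬_)
open import Relation.Nullary.Decidable using (¬?)

Array : ℕ → Set
Array n = Fin n → Fin n → ℕ

-- sum of a row / column / diagonal (diagonal: (i,i); anti-diagonal: (i, n+1-i),
-- i.e. 0-indexed (i, n-1-i) = (i, opposite i)).
rowSum : ∀ {n} → Array n → Fin n → ℕ
rowSum {n} A i = sum (map (λ j → A i j) (allFin n))

colSum : ∀ {n} → Array n → Fin n → ℕ
colSum {n} A j = sum (map (λ i → A i j) (allFin n))

leftDiagSum : ∀ {n} → Array n → ℕ
leftDiagSum {n} A = sum (map (λ i → A i i) (allFin n))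

rightDiagSum : ∀ {n} → Array n → ℕ
rightDiagSum {n} A = sum (map (λ i → A i (opposite i)) (allFin n))

lineSums : ∀ {n} → Array n → List ℕ
lineSums {n} A =
  map (rowSum A) (allFin n) ++ map (colSum A) (allFin n)
    ++ (leftDiagSum A ∷ rightDiagSum A ∷ [])

positives : List ℕ → ℕ
positives xs = length (filter (λ x → ¬? (x ≟ 0)) xs)

-- SAMS(n,d): entries in {0,…,nd}, each of 1..nd occurs in exactly one entry,
-- and the 2n+2 line sums form a set of 2n+2 consecutive integers
-- (i.e. the list of line sums is a permutation of a, a+1, …, a+2n+1).
IsSAMS : (n d : ℕ) → Array n → Set
IsSAMS n d A =
  (∀ i j → A i j ≤ n * d)
  × (∀ k → 1 ≤ k → k ≤ n * d →
       Σ (Fin n) λ i → Σ (Fin n) λ j → A i j ≡ k ×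
         (∀ i' j' → A i' j' ≡ k → (i' ≡ i) × (j' ≡ j)))
  × ∃ λ a → lineSums A ↭ map (a +_) (upTo (2 * n + 2))

IsRegular : (n d : ℕ) → Array n → Set
IsRegular n d A =
  (∀ i → positives (map (λ j → A i j) (allFin n)) ≡ d)
  × (∀ j → positives (map (λ i → A i j) (allFin n)) ≡ d)
  × positives (map (λ i → A i i) (allFin n)) ≡ d
  × positives (map (λ i → A i (opposite i)) (allFin n)) ≡ d

RegularSAMS : (n d : ℕ) → Set
RegularSAMS n d = d < n × Σ (Array n) λ A → IsSAMS n d A × IsRegular n d A

-- Let n be coprime to 6. Row i of the array gets two entries, v₁ i in column 2i + b and v₂ i in
-- column 2i + b + 2 (mod n). As 2 is invertible mod n, column 2t + b (mod n) meets exactly the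
-- rows t and t − 1, with sum v₁ t + v₂ (t − 1); the main diagonal meets one cell of each kind
-- since i ≡ 2i + c has a unique solution, and so does the anti-diagonal since 3 is invertible
-- mod n. For n = 6k + 5 and n = 6k + 7 explicit piecewise-linear v₁, v₂ enumerate 1, …, 2n,
-- and the 2n + 2 line sums then interleave into a run of consecutive integers.
module Submission where

open import Defs
open import Data.Nat using (ℕ; zero; suc; pred; _+_; _*_; _∸_; _≤_; _<_; _≟_; _<?_; _%_; _/_; z≤n; s≤s; s≤s⁻¹; z<s; NonZero)
open import Data.Nat.Properties
open import Data.Nat.DivMod using (m≡m%n+[m/n]*n; m%n<n; m<n⇒m%n≡m; [m+kn]%n≡m%n; %-congˡ)
open import Data.Nat.Divisibility using (_∣_; divides; ∣1⇒≡1; n∣m⇒m%n≡0; ∣⇒≤)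
open import Data.Nat.Coprimality using (Coprime; coprime-divisor; coprime-+; 1-coprimeTo)
import Data.Nat.Coprimality as Coprimality
open import Data.Nat.ListAction using (sum)
open import Data.Nat.Tactic.RingSolver using (solve)
open import Data.Fin using (Fin; zero; suc; toℕ; fromℕ<; opposite)
import Data.Fin.Properties as Fin
open import Data.List using (List; []; _∷_; map; tabulate; allFin; upTo; length; _++_)
open import Data.List.Properties using (length-map; length-++; length-tabulate; length-upTo; map-tabulate)
open import Data.List.Membership.Propositional using (_∈_)
open import Data.List.Membership.Propositional.Properties
  using (∈-∃++; ∈-map⁺; ∈-map⁻; ∈-++⁺ˡ; ∈-++⁺ʳ; ∈-++⁻; ∈-upTo⁺; ∈-upTo⁻; ∈-allFin)
open import Data.List.Relation.Unary.Any using (here; there)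
import Data.List.Relation.Unary.All as All
import Data.List.Relation.Unary.AllPairs as AllPairs
open import Data.List.Relation.Unary.Unique.Propositional using (Unique)
import Data.List.Relation.Unary.Unique.Propositional.Properties as Unique
open import Data.List.Relation.Binary.Permutation.Propositional using (_↭_; ↭-refl; ↭-prep; ↭-trans; ↭-sym; ↭⇒↭ₛ)
open import Data.List.Relation.Binary.Permutation.Propositional.Properties using (shift; ∈-resp-↭)
import Data.List.Relation.Binary.Permutation.Setoid.Properties as Permutation
open import Data.Product using (Σ; ∃; ∃₂; _×_; _,_; proj₁; proj₂; uncurry)
open import Data.Sum using (_⊎_; inj₁; inj₂)
open import Data.Empty using (⊥-elim)
open import Function using (_∘_)
open import Relation.Nullary using (yes; no)
open import Relation.Binary.PropositionalEquality

∈-++-∷⁻ : ∀ {A : Set} {x y : A} xs ys → x ∈ xs ++ y ∷ ys → x ≢ y → x ∈ xs ++ ys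
∈-++-∷⁻ xs ys x∈ x≢y with ∈-++⁻ xs x∈
... | inj₁ x∈xs         = ∈-++⁺ˡ x∈xs
... | inj₂ (here x≡y)   = ⊥-elim (x≢y x≡y)
... | inj₂ (there x∈ys) = ∈-++⁺ʳ xs x∈ys

length-++-∷ : ∀ {A : Set} (xs : List A) y ys → length (xs ++ y ∷ ys) ≡ suc (length (xs ++ ys))
length-++-∷ []       y ys = refl
length-++-∷ (x ∷ xs) y ys = cong suc (length-++-∷ xs y ys)

Unique∧⊆∧length⇒↭ : ∀ {A : Set} {xs ys : List A} → Unique ys → (∀ {y} → y ∈ ys → y ∈ xs) →
                     length xs ≡ length ys → xs ↭ ys
Unique∧⊆∧length⇒↭ {xs = []}    {ys = []} _ _ _  = ↭-refl
Unique∧⊆∧length⇒↭ {xs = _ ∷ _} {ys = []} _ _ ()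
Unique∧⊆∧length⇒↭ {xs = xs} {ys = y ∷ ys} (y∉ys AllPairs.∷ ys!) ys⊆xs len
  with as , bs , refl ← ∈-∃++ (ys⊆xs (here refl)) =
  ↭-trans (shift y as bs)
    (↭-prep y (Unique∧⊆∧length⇒↭ ys! ys⊆as++bs (suc-injective (trans (sym (length-++-∷ as y bs)) len))))
  where
  ys⊆as++bs : ∀ {z} → z ∈ ys → z ∈ as ++ bs
  ys⊆as++bs z∈ys = ∈-++-∷⁻ as bs (ys⊆xs (there z∈ys)) (λ z≡y → All.lookup y∉ys z∈ys (sym z≡y))

Unique-map⇒injective : ∀ {A : Set} (f : A → ℕ) xs → Unique (map f xs) →
                       ∀ {x y} → x ∈ xs → y ∈ xs → f x ≡ f y → x ≡ y
Unique-map⇒injective f (z ∷ zs) (_  AllPairs.∷ _)  (here refl) (here refl) _ = refl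
Unique-map⇒injective f (z ∷ zs) (fz∉ AllPairs.∷ _) (here refl) (there y∈) e = ⊥-elim (All.lookup fz∉ (∈-map⁺ f y∈) e)
Unique-map⇒injective f (z ∷ zs) (fz∉ AllPairs.∷ _) (there x∈) (here refl) e = ⊥-elim (All.lookup fz∉ (∈-map⁺ f x∈) (sym e))
Unique-map⇒injective f (z ∷ zs) (_  AllPairs.∷ u)  (there x∈) (there y∈) e = Unique-map⇒injective f zs u x∈ y∈ e

injective⇒surjective : ∀ {n} (f : Fin n → Fin n) → (∀ {x y} → f x ≡ f y → x ≡ y) → ∀ y → ∃ λ x → f x ≡ y
injective⇒surjective {n} f f-inj y = let x , _ , y≡fx = ∈-map⁻ f (∈-resp-↭ allFin↭ (∈-allFin y)) in x , sym y≡fx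
  where
  allFin↭ : allFin n ↭ map f (allFin n)
  allFin↭ = Unique∧⊆∧length⇒↭ (Unique.map⁺ f-inj (Unique.allFin⁺ n)) (λ _ → ∈-allFin _)
              (sym (length-map f (allFin n)))

Covers : List ℕ → ℕ → ℕ → Set
Covers xs a m = ∀ o → o < m → a + o ∈ xs

covers⇒↭ : ∀ {xs a m} → length xs ≡ m → Covers xs a m → xs ↭ map (a +_) (upTo m)
covers⇒↭ {xs} {a} {m} len cover =
  Unique∧⊆∧length⇒↭ (Unique.map⁺ (+-cancelˡ-≡ a _ _) (Unique.upTo⁺ m)) window⊆xs
    (trans len (sym (trans (length-map (a +_) (upTo m)) (length-upTo m))))
  where
  window⊆xs : ∀ {y} → y ∈ map (a +_) (upTo m) → y ∈ xs
  window⊆xs y∈ with o , o∈ , refl ← ∈-map⁻ (a +_) y∈ = cover o (∈-upTo⁻ o∈)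

covers-single : ∀ {xs a} → a ∈ xs → Covers xs a 1
covers-single {xs} {a} a∈ zero _ = subst (_∈ xs) (sym (+-identityʳ a)) a∈
covers-single a∈ (suc _) (s≤s ())

covers-++ : ∀ {xs a b m m′} → Covers xs a m → Covers xs b m′ → a + m ≡ b → Covers xs a (m + m′)
covers-++ {xs} {a} {m = m} cover cover′ refl o o<m+m′ with o <? m
... | yes o<m = cover o o<m
... | no o≮m with r , refl ← m≤n⇒∃[o]m+o≡n (≮⇒≥ o≮m) =
  subst (_∈ xs) (+-assoc a m r) (cover′ r (+-cancelˡ-< m r _ o<m+m′))

data EvenOdd : ℕ → Set where
  even : ∀ q → EvenOdd (2 * q)
  odd  : ∀ q → EvenOdd (suc (2 * q))

evenOdd : ∀ o → EvenOdd o
evenOdd zero = even 0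
evenOdd (suc o) with evenOdd o
... | even q = odd q
... | odd q  = subst EvenOdd (cong suc (+-suc q (q + 0))) (even (suc q))

covers-interleave : ∀ {xs a} p → (∀ q → q ≤ p → a + 2 * q ∈ xs) → (∀ q → q < p → a + suc (2 * q) ∈ xs) →
                    Covers xs a (suc (2 * p))
covers-interleave p evens odds o o< with evenOdd o
... | even q = evens q (*-cancelˡ-≤ 2 (s≤s⁻¹ o<))
... | odd q  = odds q (*-cancelˡ-< 2 q p (s≤s⁻¹ o<))

TwoCellLine : ℕ → List ℕ → Set
TwoCellLine s xs = sum xs ≡ s × positives xs ≡ 2

positives-∷ : ∀ {x} xs → x ≢ 0 → positives (x ∷ xs) ≡ suc (positives xs)
positives-∷ {zero}  _ x≢0 = ⊥-elim (x≢0 refl)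
positives-∷ {suc x} _ _   = refl

tabulate-zeros : ∀ {n} (f : Fin n → ℕ) → (∀ j → f j ≡ 0) → sum (tabulate f) ≡ 0 × positives (tabulate f) ≡ 0
tabulate-zeros {zero}  f _ = refl , refl
tabulate-zeros {suc n} f f≡0 rewrite f≡0 zero = tabulate-zeros (f ∘ suc) (f≡0 ∘ suc)

tabulate-single : ∀ {n} (f : Fin n → ℕ) a → (∀ j → j ≢ a → f j ≡ 0) → f a ≢ 0 →
                  sum (tabulate f) ≡ f a × positives (tabulate f) ≡ 1
tabulate-single {suc n} f zero f≡0 fa≢0 =
  let Σ≡0 , #≡0 = tabulate-zeros (f ∘ suc) (λ j → f≡0 (suc j) λ ())
  in trans (cong (f zero +_) Σ≡0) (+-identityʳ (f zero)) , trans (positives-∷ _ fa≢0) (cong suc #≡0)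
tabulate-single {suc n} f (suc a) f≡0 fa≢0 rewrite f≡0 zero (λ ()) =
  tabulate-single (f ∘ suc) a (λ j j≢a → f≡0 (suc j) (j≢a ∘ Fin.suc-injective)) fa≢0

tabulate-pair : ∀ {n} (f : Fin n → ℕ) a c → a ≢ c → (∀ j → j ≢ a → j ≢ c → f j ≡ 0) → f a ≢ 0 → f c ≢ 0 →
                TwoCellLine (f a + f c) (tabulate f)
tabulate-pair f zero zero a≢c = ⊥-elim (a≢c refl)
tabulate-pair f zero (suc c) _ f≡0 fa≢0 fc≢0 =
  let Σ≡ , #≡1 = tabulate-single (f ∘ suc) c (λ j j≢c → f≡0 (suc j) (λ ()) (j≢c ∘ Fin.suc-injective)) fc≢0
  in cong (f zero +_) Σ≡ , trans (positives-∷ _ fa≢0) (cong suc #≡1)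
tabulate-pair f (suc a) zero _ f≡0 fa≢0 fc≢0 =
  let Σ≡ , #≡1 = tabulate-single (f ∘ suc) a (λ j j≢a → f≡0 (suc j) (j≢a ∘ Fin.suc-injective) (λ ())) fa≢0
  in trans (cong (f zero +_) Σ≡) (+-comm (f zero) (f (suc a))) , trans (positives-∷ _ fc≢0) (cong suc #≡1)
tabulate-pair f (suc a) (suc c) a≢c f≡0 rewrite f≡0 zero (λ ()) (λ ()) =
  tabulate-pair (f ∘ suc) a c (a≢c ∘ cong suc)
    (λ j j≢a j≢c → f≡0 (suc j) (j≢a ∘ Fin.suc-injective) (j≢c ∘ Fin.suc-injective))

%-reduce : ∀ {n} {{_ : NonZero n}} {x r} q → r < n → x ≡ r + q * n → x % n ≡ r
%-reduce {n} {r = r} q r<n refl = trans ([m+kn]%n≡m%n r q n) (m<n⇒m%n≡m r<n)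

%-≡⇒∣ : ∀ {n} {{_ : NonZero n}} x d → (x + d) % n ≡ x % n → n ∣ d
%-≡⇒∣ {n} x d eq = divides ((x + d) / n ∸ x / n) (begin
  d                               ≡⟨ m+n∸m≡n (x / n * n) d ⟨
  x / n * n + d ∸ x / n * n       ≡⟨ cong (_∸ x / n * n) (+-cancelˡ-≡ (x % n) _ _ quotients) ⟩
  (x + d) / n * n ∸ x / n * n     ≡⟨ *-distribʳ-∸ n ((x + d) / n) (x / n) ⟨
  ((x + d) / n ∸ x / n) * n       ∎)
  where
  open ≡-Reasoning
  quotients : x % n + (x / n * n + d) ≡ x % n + (x + d) / n * n
  quotients = begin
    x % n + (x / n * n + d)         ≡⟨ +-assoc (x % n) (x / n * n) d ⟨
    x % n + x / n * n + d           ≡⟨ cong (_+ d) (m≡m%n+[m/n]*n x n) ⟨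
    x + d                           ≡⟨ m≡m%n+[m/n]*n (x + d) n ⟩
    (x + d) % n + (x + d) / n * n   ≡⟨ cong (_+ (x + d) / n * n) eq ⟩
    x % n + (x + d) / n * n         ∎

%-residue : ∀ {n d r} {{_ : NonZero d}} → n % d ≡ r → n ≡ r + d * (n / d)
%-residue {n} {d} refl = trans (m≡m%n+[m/n]*n n d) (cong (n % d +_) (*-comm (n / d) d))

coprime-∣⇒≡0 : ∀ {n a d} {{_ : NonZero n}} → Coprime n a → n ∣ a * d → d < n → d ≡ 0
coprime-∣⇒≡0 {d = zero}  _       _    _   = refl
coprime-∣⇒≡0 {d = suc d} n⊥a n∣ad d<n = ⊥-elim (<⇒≱ d<n (∣⇒≤ (coprime-divisor n⊥a n∣ad)))

affine-injective-≤ : ∀ {n a} {{_ : NonZero n}} c → Coprime n a → ∀ {i j} → i ≤ j → j < n →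
                     (a * i + c) % n ≡ (a * j + c) % n → i ≡ j
affine-injective-≤ {n} {a} c n⊥a {i} i≤j j<n eq with d , refl ← m≤n⇒∃[o]m+o≡n i≤j =
  sym (trans (cong (i +_) d≡0) (+-identityʳ i))
  where
  shifted : a * i + c + a * d ≡ a * (i + d) + c
  shifted = solve (a ∷ i ∷ d ∷ c ∷ [])
  d≡0 : d ≡ 0
  d≡0 = coprime-∣⇒≡0 n⊥a (%-≡⇒∣ (a * i + c) (a * d) (trans (%-congˡ shifted) (sym eq)))
          (≤-<-trans (m≤n+m d i) j<n)

affine-injective : ∀ {n a} {{_ : NonZero n}} c → Coprime n a → ∀ {i j} → i < n → j < n →
                   (a * i + c) % n ≡ (a * j + c) % n → i ≡ j
affine-injective c n⊥a {i} {j} i<n j<n eq with ≤-total i j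
... | inj₁ i≤j = affine-injective-≤ c n⊥a i≤j j<n eq
... | inj₂ j≤i = sym (affine-injective-≤ c n⊥a j≤i i<n (sym eq))

affine-root-unique : ∀ {n a} {{_ : NonZero n}} c → Coprime n a → ∀ {i j} → i < n → j < n →
                     n ∣ a * i + c → n ∣ a * j + c → i ≡ j
affine-root-unique {n} {a} c n⊥a {i} {j} i<n j<n n∣i n∣j =
  affine-injective c n⊥a i<n j<n (trans (n∣m⇒m%n≡0 (a * i + c) n n∣i) (sym (n∣m⇒m%n≡0 (a * j + c) n n∣j)))

coprime-+-* : ∀ {r d} q → Coprime r d → Coprime (r + q * d) d
coprime-+-* {r}     zero    r⊥d {i} (i∣r+0 , i∣d) = r⊥d (subst (i ∣_) (+-identityʳ r) i∣r+0 , i∣d)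
coprime-+-* {r} {d} (suc q) r⊥d {i} (i∣ , i∣d)    =
  coprime-+ (coprime-+-* q r⊥d) (subst (i ∣_) regroup i∣ , i∣d)
  where
  regroup : r + suc q * d ≡ d + (r + q * d)
  regroup = solve (r ∷ d ∷ q ∷ [])

coprime-residue : ∀ n {r d} → Coprime r d → ∀ q → n ≡ r + q * d → Coprime n d
coprime-residue _ r⊥d q refl = coprime-+-* q r⊥d

length-lineSums : ∀ {n} (A : Array n) → length (lineSums A) ≡ 2 * n + 2
length-lineSums {n} A = begin
  length (lineSums A)          ≡⟨ length-++ (map (rowSum A) (allFin n)) ⟩
  length (map (rowSum A) (allFin n)) + length (map (colSum A) (allFin n) ++ _)
                               ≡⟨ cong₂ _+_ (#lines (rowSum A)) (trans (length-++ (map (colSum A) (allFin n)))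
                                                                       (cong (_+ 2) (#lines (colSum A)))) ⟩
  n + (n + 2)                  ≡⟨ solve (n ∷ []) ⟩
  2 * n + 2                    ∎
  where
  open ≡-Reasoning
  #lines : (f : Fin n → ℕ) → length (map f (allFin n)) ≡ n
  #lines f = trans (length-map f (allFin n)) (length-tabulate (λ i → i))

rowSum∈lineSums : ∀ {n} (A : Array n) i → rowSum A i ∈ lineSums A
rowSum∈lineSums A i = ∈-++⁺ˡ (∈-map⁺ (rowSum A) (∈-allFin i))

colSum∈lineSums : ∀ {n} (A : Array n) j → colSum A j ∈ lineSums A
colSum∈lineSums {n} A j = ∈-++⁺ʳ (map (rowSum A) (allFin n)) (∈-++⁺ˡ (∈-map⁺ (colSum A) (∈-allFin j)))

leftDiagSum∈lineSums : ∀ {n} (A : Array n) → leftDiagSum A ∈ lineSums A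
leftDiagSum∈lineSums {n} A =
  ∈-++⁺ʳ (map (rowSum A) (allFin n)) (∈-++⁺ʳ (map (colSum A) (allFin n)) (here refl))

rightDiagSum∈lineSums : ∀ {n} (A : Array n) → rightDiagSum A ∈ lineSums A
rightDiagSum∈lineSums {n} A =
  ∈-++⁺ʳ (map (rowSum A) (allFin n)) (∈-++⁺ʳ (map (colSum A) (allFin n)) (there (here refl)))

data Slot : Set where
  first second : Slot

module Construction (n b : ℕ) {{_ : NonZero n}} (v₁ v₂ : ℕ → ℕ) where

  value : Slot → ℕ → ℕ
  value first  = v₁
  value second = v₂

  offset : Slot → ℕ
  offset first  = b
  offset second = 2 + b

  column : Slot → ℕ → ℕ
  column s i = (2 * i + offset s) % n

  entry : ℕ → ℕ → ℕ
  entry i j with j ≟ column first i | j ≟ column second i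
  ... | yes _ | _     = v₁ i
  ... | no _  | yes _ = v₂ i
  ... | no _  | no _  = 0

  A : Array n
  A i j = entry (toℕ i) (toℕ j)

  data EntryView (i j : ℕ) : ℕ → Set where
    occupied : ∀ s → j ≡ column s i → EntryView i j (value s i)
    empty    : (∀ s → j ≢ column s i) → EntryView i j 0

  entryView : ∀ i j → EntryView i j (entry i j)
  entryView i j with j ≟ column first i | j ≟ column second i
  ... | yes j≡ | _      = occupied first j≡
  ... | no _   | yes j≡ = occupied second j≡
  ... | no j≢  | no j≢′ = empty λ { first → j≢ ; second → j≢′ }

  column-first≡ : ∀ i r q → 2 * i + b ≡ r + q * n → r < n → column first i ≡ r
  column-first≡ i r q eq r<n = %-reduce q r<n eq

  column-second≡ : ∀ i r q → 2 * i + (2 + b) ≡ r + q * n → r < n → column second i ≡ r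
  column-second≡ i r q eq r<n = %-reduce q r<n eq

  columnFin : Slot → ℕ → Fin n
  columnFin s i = fromℕ< (m%n<n (2 * i + offset s) n)

  toℕ-columnFin : ∀ s i → toℕ (columnFin s i) ≡ column s i
  toℕ-columnFin s i = Fin.toℕ-fromℕ< _

  prev : ℕ → ℕ
  prev zero    = pred n
  prev (suc t) = t

  prev<n : ∀ {t} → t < n → prev t < n
  prev<n {zero}  _     = subst (pred n <_) (suc-pred n) ≤-refl
  prev<n {suc t} 1+t<n = <-trans (n<1+n t) 1+t<n

  column-prev : ∀ t → column second (prev t) ≡ column first t
  column-prev zero    = trans (%-congˡ wrap) ([m+kn]%n≡m%n b 2 n)
    where
    wrap : 2 * pred n + (2 + b) ≡ b + 2 * n
    wrap = trans (regroup (pred n)) (cong (λ m → b + 2 * m) (suc-pred n))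
      where
      regroup : ∀ p → 2 * p + (2 + b) ≡ b + 2 * suc p
      regroup p = solve (p ∷ b ∷ [])
  column-prev (suc t) = %-congˡ regroup
    where
    regroup : 2 * t + (2 + b) ≡ 2 * suc t + b
    regroup = solve (t ∷ b ∷ [])

  tagged : Slot → List (Slot × ℕ)
  tagged s = map (s ,_) (upTo n)

  slots : List (Slot × ℕ)
  slots = tagged first ++ tagged second

  rowValues : List ℕ
  rowValues = map (uncurry value) slots

  ∈-slots : ∀ s {i} → i < n → (s , i) ∈ slots
  ∈-slots first  i<n = ∈-++⁺ˡ (∈-map⁺ (first ,_) (∈-upTo⁺ i<n))
  ∈-slots second i<n = ∈-++⁺ʳ (tagged first) (∈-map⁺ (second ,_) (∈-upTo⁺ i<n))

  slots-< : ∀ {s i} → (s , i) ∈ slots → i < n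
  slots-< s,i∈ with ∈-++⁻ (tagged first) s,i∈
  ... | inj₁ ∈firsts  with _ , i∈ , refl ← ∈-map⁻ (first ,_) ∈firsts  = ∈-upTo⁻ i∈
  ... | inj₂ ∈seconds with _ , i∈ , refl ← ∈-map⁻ (second ,_) ∈seconds = ∈-upTo⁻ i∈

  length-rowValues : length rowValues ≡ n * 2
  length-rowValues = begin
    length rowValues                 ≡⟨ length-map (uncurry value) slots ⟩
    length slots                     ≡⟨ length-++ (tagged first) ⟩
    length (tagged first) + length (tagged second)
                                     ≡⟨ cong₂ _+_ (#tagged first) (#tagged second) ⟩
    n + n                            ≡⟨ solve (n ∷ []) ⟩
    n * 2                            ∎
    where
    open ≡-Reasoning
    #tagged : ∀ s → length (tagged s) ≡ n
    #tagged s = trans (length-map (s ,_) (upTo n)) (length-upTo n)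

  value-∈ : ∀ s {i} → i < n → value s i ∈ rowValues
  value-∈ s i<n = ∈-map⁺ (uncurry value) (∈-slots s i<n)

  ∈-rowValues : ∀ {x} → x ∈ rowValues → ∃₂ λ s i → i < n × value s i ≡ x
  ∈-rowValues x∈ with (s , i) , s,i∈ , refl ← ∈-map⁻ (uncurry value) x∈ = s , i , slots-< s,i∈ , refl

  module Properties (2<n : 2 < n) (n⊥2 : Coprime n 2) (n⊥3 : Coprime n 3)
                    (cover : Covers rowValues 1 (n * 2)) where

    rowValues↭ : rowValues ↭ map (1 +_) (upTo (n * 2))
    rowValues↭ = covers⇒↭ length-rowValues cover

    value-injective : ∀ {s s′ i j} → i < n → j < n → value s i ≡ value s′ j → (s , i) ≡ (s′ , j)
    value-injective i<n j<n = Unique-map⇒injective (uncurry value) slots unique (∈-slots _ i<n) (∈-slots _ j<n)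
      where
      unique : Unique rowValues
      unique = Permutation.Unique-resp-↭ (setoid ℕ) (↭⇒↭ₛ (↭-sym rowValues↭))
                 (Unique.map⁺ (+-cancelˡ-≡ 1 _ _) (Unique.upTo⁺ (n * 2)))

    rowValue-bounds : ∀ {x} → x ∈ rowValues → 0 < x × x ≤ n * 2
    rowValue-bounds x∈ with o , o∈ , refl ← ∈-map⁻ (1 +_) (∈-resp-↭ rowValues↭ x∈) = s≤s z≤n , ∈-upTo⁻ o∈

    value-positive : ∀ s {i} → i < n → value s i ≢ 0
    value-positive s i<n v≡0 = <⇒≢ (proj₁ (rowValue-bounds (value-∈ s i<n))) (sym v≡0)

    columns-distinct : ∀ i → column first i ≢ column second i
    columns-distinct i eq = <⇒≱ 2<n (subst (_≤ 2) (sym n≡1) (s≤s z≤n))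
      where
      regroup : 2 * i + b + 2 ≡ 2 * i + (2 + b)
      regroup = solve (i ∷ b ∷ [])
      n≡1 : n ≡ 1
      n≡1 = ∣1⇒≡1 (coprime-divisor n⊥2 (%-≡⇒∣ (2 * i + b) 2 (trans (%-congˡ regroup) (sym eq))))

    column-slot : ∀ s s′ i → column s i ≡ column s′ i → s ≡ s′
    column-slot first  first  _ _  = refl
    column-slot first  second i eq = ⊥-elim (columns-distinct i eq)
    column-slot second first  i eq = ⊥-elim (columns-distinct i (sym eq))
    column-slot second second _ _  = refl

    column-injective : ∀ s {i j} → i < n → j < n → column s i ≡ column s j → i ≡ j
    column-injective s = affine-injective (offset s) n⊥2

    entry-at : ∀ s {i j} → j ≡ column s i → entry i j ≡ value s i
    entry-at s {i} {j} j≡ with entry i j | entryView i j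
    ... | _ | occupied s′ j≡′ with refl ← column-slot s′ s i (trans (sym j≡′) j≡) = refl
    ... | _ | empty j≢                                                       = ⊥-elim (j≢ s j≡)

    entry-empty : ∀ {i j} → (∀ s → j ≢ column s i) → entry i j ≡ 0
    entry-empty {i} {j} j≢ with entry i j | entryView i j
    ... | _ | occupied s j≡ = ⊥-elim (j≢ s j≡)
    ... | _ | empty _       = refl

    line : (r c : Fin n → Fin n) (p q : Fin n) {i₁ i₂ : ℕ} →
           toℕ (r p) ≡ i₁ → toℕ (c p) ≡ column first i₁ →
           toℕ (r q) ≡ i₂ → toℕ (c q) ≡ column second i₂ →
           (∀ x → toℕ (c x) ≡ column first (toℕ (r x)) → x ≡ p) →
           (∀ x → toℕ (c x) ≡ column second (toℕ (r x)) → x ≡ q) →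
           TwoCellLine (v₁ i₁ + v₂ i₂) (map (λ x → A (r x) (c x)) (allFin n))
    line r c p q refl p-first refl q-second only-p only-q =
      subst₂ TwoCellLine (cong₂ _+_ (entry-at first p-first) (entry-at second q-second))
                         (sym (map-tabulate (λ x → x) f))
        (tabulate-pair f p q p≢q elsewhere-empty
          (value-positive first  (Fin.toℕ<n (r p)) ∘ trans (sym (entry-at first p-first)))
          (value-positive second (Fin.toℕ<n (r q)) ∘ trans (sym (entry-at second q-second))))
      where
      f : Fin n → ℕ
      f x = A (r x) (c x)
      p≢q : p ≢ q
      p≢q refl = columns-distinct (toℕ (r p)) (trans (sym p-first) q-second)
      elsewhere-empty : ∀ x → x ≢ p → x ≢ q → f x ≡ 0
      elsewhere-empty x x≢p x≢q = entry-empty λ { first e → x≢p (only-p x e) ; second e → x≢q (only-q x e) }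

    row-line : ∀ i → TwoCellLine (v₁ (toℕ i) + v₂ (toℕ i)) (map (λ j → A i j) (allFin n))
    row-line i = line (λ _ → i) (λ j → j) (columnFin first (toℕ i)) (columnFin second (toℕ i))
                   refl (toℕ-columnFin first (toℕ i)) refl (toℕ-columnFin second (toℕ i)) (only first) (only second)
      where
      only : ∀ s j → toℕ j ≡ column s (toℕ i) → j ≡ columnFin s (toℕ i)
      only s j j≡ = Fin.toℕ-injective (trans j≡ (sym (toℕ-columnFin s (toℕ i))))

    column-line : ∀ {t} → t < n → TwoCellLine (v₁ t + v₂ (prev t)) (map (λ i → A i (columnFin first t)) (allFin n))
    column-line {t} t<n =
      line (λ i → i) (λ _ → columnFin first t) (fromℕ< t<n) (fromℕ< (prev<n t<n))
        (Fin.toℕ-fromℕ< t<n) (toℕ-columnFin first t)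
        (Fin.toℕ-fromℕ< (prev<n t<n)) (trans (toℕ-columnFin first t) (sym (column-prev t)))
        only-t only-prev
      where
      only-t : ∀ i → toℕ (columnFin first t) ≡ column first (toℕ i) → i ≡ fromℕ< t<n
      only-t i i≡ = Fin.toℕ-injective (trans
        (column-injective first (Fin.toℕ<n i) t<n (trans (sym i≡) (toℕ-columnFin first t)))
        (sym (Fin.toℕ-fromℕ< t<n)))
      only-prev : ∀ i → toℕ (columnFin first t) ≡ column second (toℕ i) → i ≡ fromℕ< (prev<n t<n)
      only-prev i i≡ = Fin.toℕ-injective (trans
        (column-injective second (Fin.toℕ<n i) (prev<n t<n)
          (trans (sym i≡) (trans (toℕ-columnFin first t) (sym (column-prev t)))))
        (sym (Fin.toℕ-fromℕ< (prev<n t<n))))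

    every-column : ∀ j → ∃ λ t → t < n × columnFin first t ≡ j
    every-column j =
      let i , i↦j = injective⇒surjective (columnFin first ∘ toℕ) columnFin-injective j
      in toℕ i , Fin.toℕ<n i , i↦j
      where
      columnFin-injective : ∀ {x y} → columnFin first (toℕ x) ≡ columnFin first (toℕ y) → x ≡ y
      columnFin-injective {x} {y} eq = Fin.toℕ-injective (column-injective first (Fin.toℕ<n x) (Fin.toℕ<n y)
        (trans (sym (toℕ-columnFin first (toℕ x))) (trans (cong toℕ eq) (toℕ-columnFin first (toℕ y)))))

    diagonal-root : ∀ s {i} → i < n → i ≡ column s i → n ∣ 1 * i + offset s
    diagonal-root s {i} i<n on = %-≡⇒∣ i (1 * i + offset s) (begin
      (i + (1 * i + offset s)) % n  ≡⟨ %-congˡ (regroup (offset s)) ⟩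
      column s i                    ≡⟨ on ⟨
      i                             ≡⟨ m<n⇒m%n≡m i<n ⟨
      i % n                         ∎)
      where
      open ≡-Reasoning
      regroup : ∀ c → i + (1 * i + c) ≡ 2 * i + c
      regroup c = solve (i ∷ c ∷ [])

    antidiagonal-root : ∀ s {i r} → i + suc r ≡ n → r ≡ column s i → n ∣ 3 * i + suc (offset s)
    antidiagonal-root s {i} {r} i+1+r≡n on = %-≡⇒∣ r (3 * i + suc (offset s)) (begin
      (r + (3 * i + suc (offset s))) % n    ≡⟨ %-congˡ (regroup (offset s)) ⟩
      (2 * i + offset s + 1 * (i + suc r)) % n ≡⟨ cong (λ m → (2 * i + offset s + 1 * m) % n) i+1+r≡n ⟩
      (2 * i + offset s + 1 * n) % n        ≡⟨ [m+kn]%n≡m%n (2 * i + offset s) 1 n ⟩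
      column s i                            ≡⟨ on ⟨
      r                                     ≡⟨ m<n⇒m%n≡m (subst (r <_) i+1+r≡n (m≤n+m (suc r) i)) ⟨
      r % n                                 ∎)
      where
      open ≡-Reasoning
      regroup : ∀ c → r + (3 * i + suc c) ≡ 2 * i + c + 1 * (i + suc r)
      regroup c = solve (r ∷ i ∷ c ∷ [])

    leftDiagonal-line : ∀ {a₁ a₂} → a₁ < n → a₂ < n → a₁ ≡ column first a₁ → a₂ ≡ column second a₂ →
                        TwoCellLine (v₁ a₁ + v₂ a₂) (map (λ i → A i i) (allFin n))
    leftDiagonal-line a₁<n a₂<n on₁ on₂ =
      line (λ i → i) (λ i → i) (fromℕ< a₁<n) (fromℕ< a₂<n)
        (Fin.toℕ-fromℕ< a₁<n) (trans (Fin.toℕ-fromℕ< a₁<n) on₁)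
        (Fin.toℕ-fromℕ< a₂<n) (trans (Fin.toℕ-fromℕ< a₂<n) on₂)
        (only first a₁<n on₁) (only second a₂<n on₂)
      where
      only : ∀ s {a} (a<n : a < n) → a ≡ column s a → ∀ i → toℕ i ≡ column s (toℕ i) → i ≡ fromℕ< a<n
      only s a<n on i on-i = Fin.toℕ-injective (trans
        (affine-root-unique (offset s) (Coprimality.sym (1-coprimeTo n)) (Fin.toℕ<n i) a<n
          (diagonal-root s (Fin.toℕ<n i) on-i) (diagonal-root s a<n on))
        (sym (Fin.toℕ-fromℕ< a<n)))

    rightDiagonal-line : ∀ {a₁ r₁ a₂ r₂} → a₁ + suc r₁ ≡ n → r₁ ≡ column first a₁ →
                         a₂ + suc r₂ ≡ n → r₂ ≡ column second a₂ →
                         TwoCellLine (v₁ a₁ + v₂ a₂) (map (λ i → A i (opposite i)) (allFin n))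
    rightDiagonal-line a₁+1+r₁≡n on₁ a₂+1+r₂≡n on₂ =
      line (λ i → i) opposite (fromℕ< (<-reflected a₁+1+r₁≡n)) (fromℕ< (<-reflected a₂+1+r₂≡n))
        (Fin.toℕ-fromℕ< _) (trans (toℕ-opposite a₁+1+r₁≡n) on₁)
        (Fin.toℕ-fromℕ< _) (trans (toℕ-opposite a₂+1+r₂≡n) on₂)
        (only first a₁+1+r₁≡n on₁) (only second a₂+1+r₂≡n on₂)
      where
      <-reflected : ∀ {a r} → a + suc r ≡ n → a < n
      <-reflected {a} a+1+r≡n = subst (a <_) a+1+r≡n (m<m+n a z<s)

      toℕ-opposite : ∀ {a r} (a+1+r≡n : a + suc r ≡ n) → toℕ (opposite (fromℕ< (<-reflected a+1+r≡n))) ≡ r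
      toℕ-opposite {a} {r} a+1+r≡n = begin
        toℕ (opposite (fromℕ< (<-reflected a+1+r≡n)))  ≡⟨ Fin.opposite-prop _ ⟩
        n ∸ suc (toℕ (fromℕ< (<-reflected a+1+r≡n)))  ≡⟨ cong (λ x → n ∸ suc x) (Fin.toℕ-fromℕ< _) ⟩
        n ∸ suc a                                      ≡⟨ cong (_∸ suc a) (trans (sym a+1+r≡n) (+-suc a r)) ⟩
        suc a + r ∸ suc a                              ≡⟨ m+n∸m≡n (suc a) r ⟩
        r                                              ∎
        where open ≡-Reasoning

      reflection : ∀ (i : Fin n) → toℕ i + suc (toℕ (opposite i)) ≡ n
      reflection i = begin
        toℕ i + suc (toℕ (opposite i))      ≡⟨ +-suc (toℕ i) _ ⟩
        suc (toℕ i) + toℕ (opposite i)      ≡⟨ cong (suc (toℕ i) +_) (Fin.opposite-prop i) ⟩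
        suc (toℕ i) + (n ∸ suc (toℕ i))     ≡⟨ m+[n∸m]≡n (Fin.toℕ<n i) ⟩
        n                                   ∎
        where open ≡-Reasoning

      only : ∀ s {a r} (a+1+r≡n : a + suc r ≡ n) → r ≡ column s a →
             ∀ i → toℕ (opposite i) ≡ column s (toℕ i) → i ≡ fromℕ< (<-reflected a+1+r≡n)
      only s a+1+r≡n on i on-i = Fin.toℕ-injective (trans
        (affine-root-unique (suc (offset s)) n⊥3 (Fin.toℕ<n i) (<-reflected a+1+r≡n)
          (antidiagonal-root s (reflection i) on-i) (antidiagonal-root s a+1+r≡n on))
        (sym (Fin.toℕ-fromℕ< _)))

    entry-bound : ∀ i j → A i j ≤ n * 2
    entry-bound i j with A i j | entryView (toℕ i) (toℕ j)
    ... | _ | occupied s _ = proj₂ (rowValue-bounds (value-∈ s (Fin.toℕ<n i)))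
    ... | _ | empty _      = z≤n

    occupied-cell : ∀ i j → entry i j ≢ 0 → ∃ λ s → j ≡ column s i × entry i j ≡ value s i
    occupied-cell i j entry≢0 with entry i j | entryView i j
    ... | _ | occupied s j≡ = s , j≡ , refl
    ... | _ | empty _       = ⊥-elim (entry≢0 refl)

    unique-cell : ∀ k → 1 ≤ k → k ≤ n * 2 →
                  Σ (Fin n) λ i → Σ (Fin n) λ j → A i j ≡ k × (∀ i′ j′ → A i′ j′ ≡ k → (i′ ≡ i) × (j′ ≡ j))
    unique-cell (suc o) _ 1+o≤2n with s , i , i<n , v≡k ← ∈-rowValues (cover o 1+o≤2n) =
      fromℕ< i<n , columnFin s i , trans at-cell v≡k , elsewhere
      where
      at-cell : A (fromℕ< i<n) (columnFin s i) ≡ value s i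
      at-cell rewrite Fin.toℕ-fromℕ< i<n = entry-at s (toℕ-columnFin s i)
      elsewhere : ∀ i′ j′ → A i′ j′ ≡ suc o → (i′ ≡ fromℕ< i<n) × (j′ ≡ columnFin s i)
      elsewhere i′ j′ A≡k
        with s′ , j′≡ , A≡v ← occupied-cell (toℕ i′) (toℕ j′) (λ A≡0 → 1+n≢0 (trans (sym A≡k) A≡0))
        with refl ← value-injective (Fin.toℕ<n i′) i<n (trans (sym A≡v) (trans A≡k (sym v≡k))) =
        Fin.toℕ-injective (sym (Fin.toℕ-fromℕ< i<n)) ,
        Fin.toℕ-injective (trans j′≡ (sym (toℕ-columnFin s′ (toℕ i′))))

    rowSum∈ : ∀ {i} → i < n → v₁ i + v₂ i ∈ lineSums A
    rowSum∈ i<n = subst (_∈ lineSums A)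
      (trans (proj₁ (row-line (fromℕ< i<n))) (cong (λ x → v₁ x + v₂ x) (Fin.toℕ-fromℕ< i<n)))
      (rowSum∈lineSums A (fromℕ< i<n))

    colSum∈ : ∀ {t} → t < n → v₁ t + v₂ (prev t) ∈ lineSums A
    colSum∈ {t} t<n = subst (_∈ lineSums A) (proj₁ (column-line t<n)) (colSum∈lineSums A (columnFin first t))

    regularSAMS : positives (map (λ i → A i i) (allFin n)) ≡ 2 →
                  positives (map (λ i → A i (opposite i)) (allFin n)) ≡ 2 →
                  ∀ {a} → Covers (lineSums A) a (2 * n + 2) → RegularSAMS n 2
    regularSAMS left right {a} cover-lines =
      2<n , A , (entry-bound , unique-cell , a , covers⇒↭ (length-lineSums A) cover-lines) ,
      (proj₂ ∘ row-line , column-regular , left , right)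
      where
      column-regular : ∀ j → positives (map (λ i → A i j) (allFin n)) ≡ 2
      column-regular j with t , t<n , refl ← every-column j = proj₂ (column-line t<n)

<-witness : ∀ {a b} e → a + suc e ≡ b → a < b
<-witness {a} e refl = m<m+n a z<s

+-<-witness : ∀ a {q c} e {b} → q < c → a + c + e ≡ b → a + q < b
+-<-witness a {c = c} e q<c refl = ≤-trans (+-monoʳ-< a q<c) (m≤m+n (a + c) e)

-- Opaque, so that the arguments c f g of the lemmas below are found by unification.
opaque
  piecewise : ℕ → (ℕ → ℕ) → (ℕ → ℕ) → ℕ → ℕ
  piecewise c f g i with i <? c
  ... | yes _ = f i
  ... | no  _ = g (i ∸ c)

  piecewise-< : ∀ {c f g i} → i < c → piecewise c f g i ≡ f i
  piecewise-< {c} {i = i} i<c with i <? c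
  ... | yes _   = refl
  ... | no  i≮c = ⊥-elim (i≮c i<c)

  piecewise-≥ : ∀ {c f g i} → c ≤ i → piecewise c f g i ≡ g (i ∸ c)
  piecewise-≥ {c} {i = i} c≤i with i <? c
  ... | yes i<c = ⊥-elim (<⇒≱ i<c c≤i)
  ... | no  _   = refl

piecewise-+ : ∀ {c f g} q → piecewise c f g (c + q) ≡ g q
piecewise-+ {c} {g = g} q = trans (piecewise-≥ (m≤m+n c q)) (cong g (m+n∸m≡n c q))

module Order5Mod6 (k : ℕ) where

  v₁ v₂ : ℕ → ℕ
  v₁ = piecewise (2 + 3 * k) (9 + 9 * k +_) (piecewise (2 + 3 * k) (7 + 6 * k +_) (λ _ → 4 + 3 * k))
  v₂ = piecewise (2 + 3 * k) (5 + 3 * k +_) (piecewise (2 + 3 * k) (1 +_)         (λ _ → 3 + 3 * k))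

  v₁-low : ∀ {q} → q < 2 + 3 * k → v₁ q ≡ 9 + 9 * k + q
  v₁-low = piecewise-<

  v₂-low : ∀ {q} → q < 2 + 3 * k → v₂ q ≡ 5 + 3 * k + q
  v₂-low = piecewise-<

  v₁-mid : ∀ i q → i ≡ 2 + 3 * k + q → q < 2 + 3 * k → v₁ i ≡ 7 + 6 * k + q
  v₁-mid _ q refl q< = trans (piecewise-+ q) (piecewise-< q<)

  v₂-mid : ∀ i q → i ≡ 2 + 3 * k + q → q < 2 + 3 * k → v₂ i ≡ 1 + q
  v₂-mid _ q refl q< = trans (piecewise-+ q) (piecewise-< q<)

  top≡ : 4 + 6 * k ≡ 2 + 3 * k + (2 + 3 * k)
  top≡ = solve (k ∷ [])

  v₁-top : v₁ (4 + 6 * k) ≡ 4 + 3 * k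
  v₁-top = trans (cong v₁ top≡) (trans (piecewise-+ (2 + 3 * k)) (piecewise-≥ ≤-refl))

  v₂-top : v₂ (4 + 6 * k) ≡ 3 + 3 * k
  v₂-top = trans (cong v₂ top≡) (trans (piecewise-+ (2 + 3 * k)) (piecewise-≥ ≤-refl))

  low<n : ∀ {q} → q < 2 + 3 * k → q < 5 + 6 * k
  low<n q< = +-<-witness 0 (3 + 3 * k) {5 + 6 * k} q< (solve (k ∷ []))

  mid<n : ∀ {q} → q < 2 + 3 * k → 2 + 3 * k + q < 5 + 6 * k
  mid<n q< = +-<-witness (2 + 3 * k) 1 {5 + 6 * k} q< (solve (k ∷ []))

  open Construction (5 + 6 * k) 1 v₁ v₂

  values-cover : Covers rowValues 1 ((5 + 6 * k) * 2)
  values-cover = subst (Covers rowValues 1) total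
    (covers-++ v₂-mids (covers-++ v₂-top∈ (covers-++ v₁-top∈ (covers-++ v₂-lows
      (covers-++ v₁-mids v₁-lows (solve (k ∷ []))) (solve (k ∷ []))) (solve (k ∷ []))) (solve (k ∷ []))) refl)
    where
    total : 2 + 3 * k + (1 + (1 + (2 + 3 * k + (2 + 3 * k + (2 + 3 * k))))) ≡ (5 + 6 * k) * 2
    total = solve (k ∷ [])
    v₂-mids : Covers rowValues 1 (2 + 3 * k)
    v₂-mids q q< = subst (_∈ rowValues) (v₂-mid _ q refl q<) (value-∈ second (mid<n q<))
    v₂-top∈ : Covers rowValues (3 + 3 * k) 1
    v₂-top∈ = covers-single (subst (_∈ rowValues) v₂-top (value-∈ second ≤-refl))
    v₁-top∈ : Covers rowValues (4 + 3 * k) 1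
    v₁-top∈ = covers-single (subst (_∈ rowValues) v₁-top (value-∈ first ≤-refl))
    v₂-lows : Covers rowValues (5 + 3 * k) (2 + 3 * k)
    v₂-lows q q< = subst (_∈ rowValues) (v₂-low q<) (value-∈ second (low<n q<))
    v₁-mids : Covers rowValues (7 + 6 * k) (2 + 3 * k)
    v₁-mids q q< = subst (_∈ rowValues) (v₁-mid _ q refl q<) (value-∈ first (mid<n q<))
    v₁-lows : Covers rowValues (9 + 9 * k) (2 + 3 * k)
    v₁-lows q q< = subst (_∈ rowValues) (v₁-low q<) (value-∈ first (low<n q<))

  n⊥2 : Coprime (5 + 6 * k) 2
  n⊥2 = coprime-residue (5 + 6 * k) (1-coprimeTo 2) (2 + 3 * k) (solve (k ∷ []))

  n⊥3 : Coprime (5 + 6 * k) 3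
  n⊥3 = coprime-residue (5 + 6 * k) (Coprimality.sym (coprime-+ (1-coprimeTo 2))) (1 + 2 * k) (solve (k ∷ []))

  open Properties (s≤s (s≤s (s≤s z≤n))) n⊥2 n⊥3 values-cover

  left : TwoCellLine (v₁ (4 + 6 * k) + v₂ (2 + 6 * k)) (map (λ i → A i i) (allFin (5 + 6 * k)))
  left = leftDiagonal-line ≤-refl (+-monoˡ-< (6 * k) {2} {5} (s≤s (s≤s (s≤s z≤n))))
           (sym (column-first≡ (4 + 6 * k) (4 + 6 * k) 1 (solve (k ∷ [])) ≤-refl))
           (sym (column-second≡ (2 + 6 * k) (2 + 6 * k) 1 (solve (k ∷ [])) (+-monoˡ-< (6 * k) {2} {5} (s≤s (s≤s (s≤s z≤n))))))

  right : TwoCellLine (v₁ (1 + 2 * k) + v₂ (2 + 4 * k)) (map (λ i → A i (opposite i)) (allFin (5 + 6 * k)))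
  right = rightDiagonal-line {1 + 2 * k} {3 + 4 * k} {2 + 4 * k} {2 + 2 * k}
            (solve (k ∷ [])) (sym (column-first≡ (1 + 2 * k) (3 + 4 * k) 0 (solve (k ∷ [])) (<-witness {3 + 4 * k} {5 + 6 * k} (1 + 2 * k) (solve (k ∷ [])))))
            (solve (k ∷ [])) (sym (column-second≡ (2 + 4 * k) (2 + 2 * k) 1 (solve (k ∷ [])) (<-witness {2 + 2 * k} {5 + 6 * k} (2 + 4 * k) (solve (k ∷ [])))))

  open ≡-Reasoning

  left∈ : Covers (lineSums A) (5 + 6 * k) 1
  left∈ = covers-single (subst (_∈ lineSums A) (begin
    leftDiagSum A                     ≡⟨ proj₁ left ⟩
    v₁ (4 + 6 * k) + v₂ (2 + 6 * k)   ≡⟨ cong₂ _+_ v₁-top (v₂-mid (2 + 6 * k) (3 * k) (solve (k ∷ [])) (m≤n+m _ 1)) ⟩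
    4 + 3 * k + (1 + 3 * k)           ≡⟨ solve (k ∷ []) ⟩
    5 + 6 * k                         ∎) (leftDiagSum∈lineSums A))

  top-column∈ : Covers (lineSums A) (6 + 6 * k) 1
  top-column∈ = covers-single (subst (_∈ lineSums A) (begin
    v₁ (4 + 6 * k) + v₂ (3 + 6 * k)   ≡⟨ cong₂ _+_ v₁-top (v₂-mid (3 + 6 * k) (1 + 3 * k) (solve (k ∷ [])) ≤-refl) ⟩
    4 + 3 * k + (1 + (1 + 3 * k))     ≡⟨ solve (k ∷ []) ⟩
    6 + 6 * k                         ∎) (colSum∈ {4 + 6 * k} ≤-refl))

  top-row∈ : Covers (lineSums A) (7 + 6 * k) 1
  top-row∈ = covers-single (subst (_∈ lineSums A) (begin
    v₁ (4 + 6 * k) + v₂ (4 + 6 * k)   ≡⟨ cong₂ _+_ v₁-top v₂-top ⟩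
    4 + 3 * k + (3 + 3 * k)           ≡⟨ solve (k ∷ []) ⟩
    7 + 6 * k                         ∎) (rowSum∈ {4 + 6 * k} ≤-refl))

  upper-half : Covers (lineSums A) (8 + 6 * k) (suc (2 * (1 + 3 * k)))
  upper-half = covers-interleave (1 + 3 * k) rows columns
    where
    rows : ∀ q → q ≤ 1 + 3 * k → 8 + 6 * k + 2 * q ∈ lineSums A
    rows q q≤ = subst (_∈ lineSums A) (begin
      v₁ (2 + 3 * k + q) + v₂ (2 + 3 * k + q)
        ≡⟨ cong₂ _+_ (v₁-mid _ q refl (s≤s q≤)) (v₂-mid _ q refl (s≤s q≤)) ⟩
      7 + 6 * k + q + (1 + q)           ≡⟨ solve (k ∷ q ∷ []) ⟩
      8 + 6 * k + 2 * q                 ∎) (rowSum∈ (mid<n (s≤s q≤)))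
    columns : ∀ q → q < 1 + 3 * k → 8 + 6 * k + suc (2 * q) ∈ lineSums A
    columns q q< = subst (_∈ lineSums A) (begin
      v₁ (suc (2 + 3 * k + q)) + v₂ (2 + 3 * k + q)
        ≡⟨ cong₂ _+_ (v₁-mid _ (suc q) (sym (+-suc (2 + 3 * k) q)) (s≤s q<)) (v₂-mid _ q refl (m<n⇒m<1+n q<)) ⟩
      7 + 6 * k + suc q + (1 + q)       ≡⟨ solve (k ∷ q ∷ []) ⟩
      8 + 6 * k + suc (2 * q)           ∎) (colSum∈ (+-<-witness (3 + 3 * k) 1 {5 + 6 * k} q< (solve (k ∷ []))))

  right∈ : Covers (lineSums A) (11 + 12 * k) 1
  right∈ = covers-single (subst (_∈ lineSums A) (begin
    rightDiagSum A                    ≡⟨ proj₁ right ⟩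
    v₁ (1 + 2 * k) + v₂ (2 + 4 * k)
      ≡⟨ cong₂ _+_ (v₁-low (<-witness {1 + 2 * k} {2 + 3 * k} k (solve (k ∷ []))))
                   (v₂-mid (2 + 4 * k) k (solve (k ∷ [])) (<-witness {k} {2 + 3 * k} (1 + 2 * k) (solve (k ∷ [])))) ⟩
    9 + 9 * k + (1 + 2 * k) + (1 + k) ≡⟨ solve (k ∷ []) ⟩
    11 + 12 * k                       ∎) (rightDiagSum∈lineSums A))

  first-column∈ : Covers (lineSums A) (12 + 12 * k) 1
  first-column∈ = covers-single (subst (_∈ lineSums A) (begin
    v₁ 0 + v₂ (4 + 6 * k)             ≡⟨ cong₂ _+_ (v₁-low (s≤s z≤n)) v₂-top ⟩
    9 + 9 * k + 0 + (3 + 3 * k)       ≡⟨ solve (k ∷ []) ⟩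
    12 + 12 * k                       ∎) (colSum∈ {0} (s≤s z≤n)))

  middle-column∈ : Covers (lineSums A) (13 + 12 * k) 1
  middle-column∈ = covers-single (subst (_∈ lineSums A) (begin
    v₁ (2 + 3 * k) + v₂ (1 + 3 * k)
      ≡⟨ cong₂ _+_ (v₁-mid (2 + 3 * k) 0 (sym (+-identityʳ _)) (s≤s z≤n)) (v₂-low ≤-refl) ⟩
    7 + 6 * k + 0 + (5 + 3 * k + (1 + 3 * k)) ≡⟨ solve (k ∷ []) ⟩
    13 + 12 * k                       ∎) (colSum∈ {2 + 3 * k} (<-witness {2 + 3 * k} {5 + 6 * k} (2 + 3 * k) (solve (k ∷ [])))))

  lower-half : Covers (lineSums A) (14 + 12 * k) (suc (2 * (1 + 3 * k)))
  lower-half = covers-interleave (1 + 3 * k) rows columns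
    where
    rows : ∀ q → q ≤ 1 + 3 * k → 14 + 12 * k + 2 * q ∈ lineSums A
    rows q q≤ = subst (_∈ lineSums A) (begin
      v₁ q + v₂ q                       ≡⟨ cong₂ _+_ (v₁-low (s≤s q≤)) (v₂-low (s≤s q≤)) ⟩
      9 + 9 * k + q + (5 + 3 * k + q)   ≡⟨ solve (k ∷ q ∷ []) ⟩
      14 + 12 * k + 2 * q               ∎) (rowSum∈ (low<n (s≤s q≤)))
    columns : ∀ q → q < 1 + 3 * k → 14 + 12 * k + suc (2 * q) ∈ lineSums A
    columns q q< = subst (_∈ lineSums A) (begin
      v₁ (suc q) + v₂ q                 ≡⟨ cong₂ _+_ (v₁-low (s≤s q<)) (v₂-low (m<n⇒m<1+n q<)) ⟩
      9 + 9 * k + suc q + (5 + 3 * k + q) ≡⟨ solve (k ∷ q ∷ []) ⟩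
      14 + 12 * k + suc (2 * q)         ∎) (colSum∈ (low<n (s≤s q<)))

  lines : Covers (lineSums A) (5 + 6 * k) (2 * (5 + 6 * k) + 2)
  lines = subst (Covers (lineSums A) (5 + 6 * k)) total
    (covers-++ left∈ (covers-++ top-column∈ (covers-++ top-row∈ (covers-++ upper-half
      (covers-++ right∈ (covers-++ first-column∈ (covers-++ middle-column∈ lower-half
        (solve (k ∷ []))) (solve (k ∷ []))) (solve (k ∷ []))) (solve (k ∷ [])))
        (solve (k ∷ []))) (solve (k ∷ []))) (solve (k ∷ [])))
    where
    total : 1 + (1 + (1 + (suc (2 * (1 + 3 * k)) + (1 + (1 + (1 + suc (2 * (1 + 3 * k))))))))
            ≡ 2 * (5 + 6 * k) + 2
    total = solve (k ∷ [])

  regular : RegularSAMS (5 + 6 * k) 2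
  regular = regularSAMS (proj₂ left) (proj₂ right) lines

module Order1Mod6 (k : ℕ) where

  v₁ v₂ : ℕ → ℕ
  v₁ = piecewise 1 (λ _ → 14 + 12 * k) (piecewise (3 + 3 * k) (9 + 6 * k +_) (piecewise 1 (λ _ → 5 + 3 * k) (12 + 9 * k +_)))
  v₂ = piecewise 1 (λ _ → 8 + 6 * k)   (piecewise (3 + 3 * k) (1 +_)         (piecewise 1 (λ _ → 4 + 3 * k) (6 + 3 * k +_)))

  v₁-zero : v₁ 0 ≡ 14 + 12 * k
  v₁-zero = piecewise-< (s≤s z≤n)

  v₂-zero : v₂ 0 ≡ 8 + 6 * k
  v₂-zero = piecewise-< (s≤s z≤n)

  v₁-low : ∀ {q} → q < 3 + 3 * k → v₁ (suc q) ≡ 9 + 6 * k + q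
  v₁-low {q} q< = trans (piecewise-+ q) (piecewise-< q<)

  v₂-low : ∀ {q} → q < 3 + 3 * k → v₂ (suc q) ≡ 1 + q
  v₂-low {q} q< = trans (piecewise-+ q) (piecewise-< q<)

  middle≡ : 4 + 3 * k ≡ 1 + (3 + 3 * k + 0)
  middle≡ = solve (k ∷ [])

  v₁-middle : v₁ (4 + 3 * k) ≡ 5 + 3 * k
  v₁-middle = trans (cong v₁ middle≡) (trans (piecewise-+ _) (trans (piecewise-+ 0) (piecewise-< (s≤s z≤n))))

  v₂-middle : v₂ (4 + 3 * k) ≡ 4 + 3 * k
  v₂-middle = trans (cong v₂ middle≡) (trans (piecewise-+ _) (trans (piecewise-+ 0) (piecewise-< (s≤s z≤n))))

  high≡ : ∀ q → 5 + 3 * k + q ≡ 1 + (3 + 3 * k + (1 + q))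
  high≡ q = solve (k ∷ q ∷ [])

  v₁-high : ∀ i q → i ≡ 5 + 3 * k + q → v₁ i ≡ 12 + 9 * k + q
  v₁-high _ q refl = trans (cong v₁ (high≡ q)) (trans (piecewise-+ _) (trans (piecewise-+ (1 + q)) (piecewise-+ q)))

  v₂-high : ∀ i q → i ≡ 5 + 3 * k + q → v₂ i ≡ 6 + 3 * k + q
  v₂-high _ q refl = trans (cong v₂ (high≡ q)) (trans (piecewise-+ _) (trans (piecewise-+ (1 + q)) (piecewise-+ q)))

  low<n : ∀ {q} → q < 3 + 3 * k → suc q < 7 + 6 * k
  low<n q< = +-<-witness 1 (3 + 3 * k) {7 + 6 * k} q< (solve (k ∷ []))

  high<n : ∀ {q} → q < 2 + 3 * k → 5 + 3 * k + q < 7 + 6 * k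
  high<n q< = +-<-witness (5 + 3 * k) 0 {7 + 6 * k} q< (solve (k ∷ []))

  middle<n : 4 + 3 * k < 7 + 6 * k
  middle<n = <-witness {4 + 3 * k} {7 + 6 * k} (2 + 3 * k) (solve (k ∷ []))

  open Construction (7 + 6 * k) (3 + 3 * k) v₁ v₂

  values-cover : Covers rowValues 1 ((7 + 6 * k) * 2)
  values-cover = subst (Covers rowValues 1) total
    (covers-++ v₂-lows (covers-++ v₂-middle∈ (covers-++ v₁-middle∈ (covers-++ v₂-highs
      (covers-++ v₂-zero∈ (covers-++ v₁-lows (covers-++ v₁-highs v₁-zero∈
        (solve (k ∷ []))) (solve (k ∷ []))) (solve (k ∷ []))) (solve (k ∷ [])))
        (solve (k ∷ []))) (solve (k ∷ []))) (solve (k ∷ [])))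
    where
    total : 3 + 3 * k + (1 + (1 + (2 + 3 * k + (1 + (3 + 3 * k + (2 + 3 * k + 1)))))) ≡ (7 + 6 * k) * 2
    total = solve (k ∷ [])
    v₂-lows : Covers rowValues 1 (3 + 3 * k)
    v₂-lows q q< = subst (_∈ rowValues) (v₂-low q<) (value-∈ second (low<n q<))
    v₂-middle∈ : Covers rowValues (4 + 3 * k) 1
    v₂-middle∈ = covers-single (subst (_∈ rowValues) v₂-middle (value-∈ second middle<n))
    v₁-middle∈ : Covers rowValues (5 + 3 * k) 1
    v₁-middle∈ = covers-single (subst (_∈ rowValues) v₁-middle (value-∈ first middle<n))
    v₂-highs : Covers rowValues (6 + 3 * k) (2 + 3 * k)
    v₂-highs q q< = subst (_∈ rowValues) (v₂-high _ q refl) (value-∈ second (high<n q<))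
    v₂-zero∈ : Covers rowValues (8 + 6 * k) 1
    v₂-zero∈ = covers-single (subst (_∈ rowValues) v₂-zero (value-∈ second (s≤s z≤n)))
    v₁-lows : Covers rowValues (9 + 6 * k) (3 + 3 * k)
    v₁-lows q q< = subst (_∈ rowValues) (v₁-low q<) (value-∈ first (low<n q<))
    v₁-highs : Covers rowValues (12 + 9 * k) (2 + 3 * k)
    v₁-highs q q< = subst (_∈ rowValues) (v₁-high _ q refl) (value-∈ first (high<n q<))
    v₁-zero∈ : Covers rowValues (14 + 12 * k) 1
    v₁-zero∈ = covers-single (subst (_∈ rowValues) v₁-zero (value-∈ first (s≤s z≤n)))

  n⊥2 : Coprime (7 + 6 * k) 2
  n⊥2 = coprime-residue (7 + 6 * k) (1-coprimeTo 2) (3 + 3 * k) (solve (k ∷ []))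

  n⊥3 : Coprime (7 + 6 * k) 3
  n⊥3 = coprime-residue (7 + 6 * k) (1-coprimeTo 3) (2 + 2 * k) (solve (k ∷ []))

  open Properties (s≤s (s≤s (s≤s z≤n))) n⊥2 n⊥3 values-cover

  left : TwoCellLine (v₁ (4 + 3 * k) + v₂ (2 + 3 * k)) (map (λ i → A i i) (allFin (7 + 6 * k)))
  left = leftDiagonal-line middle<n (<-witness {2 + 3 * k} {7 + 6 * k} (4 + 3 * k) (solve (k ∷ [])))
           (sym (column-first≡ (4 + 3 * k) (4 + 3 * k) 1 (solve (k ∷ [])) middle<n))
           (sym (column-second≡ (2 + 3 * k) (2 + 3 * k) 1 (solve (k ∷ [])) (<-witness {2 + 3 * k} {7 + 6 * k} (4 + 3 * k) (solve (k ∷ [])))))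

  right : TwoCellLine (v₁ (1 + k) + v₂ (5 + 5 * k)) (map (λ i → A i (opposite i)) (allFin (7 + 6 * k)))
  right = rightDiagonal-line {1 + k} {5 + 5 * k} {5 + 5 * k} {1 + k}
            (solve (k ∷ [])) (sym (column-first≡ (1 + k) (5 + 5 * k) 0 (solve (k ∷ [])) (<-witness {5 + 5 * k} {7 + 6 * k} (1 + k) (solve (k ∷ [])))))
            (solve (k ∷ [])) (sym (column-second≡ (5 + 5 * k) (1 + k) 2 (solve (k ∷ [])) (<-witness {1 + k} {7 + 6 * k} (5 + 5 * k) (solve (k ∷ [])))))

  open ≡-Reasoning

  left∈ : Covers (lineSums A) (7 + 6 * k) 1
  left∈ = covers-single (subst (_∈ lineSums A) (begin
    leftDiagSum A                     ≡⟨ proj₁ left ⟩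
    v₁ (4 + 3 * k) + v₂ (2 + 3 * k)   ≡⟨ cong₂ _+_ v₁-middle (v₂-low (m≤n+m _ 1)) ⟩
    5 + 3 * k + (1 + (1 + 3 * k))     ≡⟨ solve (k ∷ []) ⟩
    7 + 6 * k                         ∎) (leftDiagSum∈lineSums A))

  middle-column∈ : Covers (lineSums A) (8 + 6 * k) 1
  middle-column∈ = covers-single (subst (_∈ lineSums A) (begin
    v₁ (4 + 3 * k) + v₂ (3 + 3 * k)   ≡⟨ cong₂ _+_ v₁-middle (v₂-low ≤-refl) ⟩
    5 + 3 * k + (1 + (2 + 3 * k))     ≡⟨ solve (k ∷ []) ⟩
    8 + 6 * k                         ∎) (colSum∈ middle<n))

  middle-row∈ : Covers (lineSums A) (9 + 6 * k) 1
  middle-row∈ = covers-single (subst (_∈ lineSums A) (begin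
    v₁ (4 + 3 * k) + v₂ (4 + 3 * k)   ≡⟨ cong₂ _+_ v₁-middle v₂-middle ⟩
    5 + 3 * k + (4 + 3 * k)           ≡⟨ solve (k ∷ []) ⟩
    9 + 6 * k                         ∎) (rowSum∈ middle<n))

  lower-half : Covers (lineSums A) (10 + 6 * k) (suc (2 * (2 + 3 * k)))
  lower-half = covers-interleave (2 + 3 * k) rows columns
    where
    rows : ∀ q → q ≤ 2 + 3 * k → 10 + 6 * k + 2 * q ∈ lineSums A
    rows q q≤ = subst (_∈ lineSums A) (begin
      v₁ (suc q) + v₂ (suc q)           ≡⟨ cong₂ _+_ (v₁-low (s≤s q≤)) (v₂-low (s≤s q≤)) ⟩
      9 + 6 * k + q + (1 + q)           ≡⟨ solve (k ∷ q ∷ []) ⟩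
      10 + 6 * k + 2 * q                ∎) (rowSum∈ (low<n (s≤s q≤)))
    columns : ∀ q → q < 2 + 3 * k → 10 + 6 * k + suc (2 * q) ∈ lineSums A
    columns q q< = subst (_∈ lineSums A) (begin
      v₁ (suc (suc q)) + v₂ (suc q)     ≡⟨ cong₂ _+_ (v₁-low (s≤s q<)) (v₂-low (m<n⇒m<1+n q<)) ⟩
      9 + 6 * k + suc q + (1 + q)       ≡⟨ solve (k ∷ q ∷ []) ⟩
      10 + 6 * k + suc (2 * q)          ∎) (colSum∈ (low<n (s≤s q<)))

  right∈ : Covers (lineSums A) (15 + 12 * k) 1
  right∈ = covers-single (subst (_∈ lineSums A) (begin
    rightDiagSum A                    ≡⟨ proj₁ right ⟩
    v₁ (1 + k) + v₂ (5 + 5 * k)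
      ≡⟨ cong₂ _+_ (v₁-low (<-witness {k} {3 + 3 * k} (2 + 2 * k) (solve (k ∷ []))))
                   (v₂-high (5 + 5 * k) (2 * k) (solve (k ∷ []))) ⟩
    9 + 6 * k + k + (6 + 3 * k + 2 * k) ≡⟨ solve (k ∷ []) ⟩
    15 + 12 * k                       ∎) (rightDiagSum∈lineSums A))

  high-column∈ : Covers (lineSums A) (16 + 12 * k) 1
  high-column∈ = covers-single (subst (_∈ lineSums A) (begin
    v₁ (5 + 3 * k) + v₂ (4 + 3 * k)   ≡⟨ cong₂ _+_ (v₁-high (5 + 3 * k) 0 (sym (+-identityʳ _))) v₂-middle ⟩
    12 + 9 * k + 0 + (4 + 3 * k)      ≡⟨ solve (k ∷ []) ⟩
    16 + 12 * k                       ∎) (colSum∈ (<-witness {5 + 3 * k} {7 + 6 * k} (1 + 3 * k) (solve (k ∷ [])))))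

  second-column∈ : Covers (lineSums A) (17 + 12 * k) 1
  second-column∈ = covers-single (subst (_∈ lineSums A) (begin
    v₁ 1 + v₂ 0                       ≡⟨ cong₂ _+_ (v₁-low (s≤s z≤n)) v₂-zero ⟩
    9 + 6 * k + 0 + (8 + 6 * k)       ≡⟨ solve (k ∷ []) ⟩
    17 + 12 * k                       ∎) (colSum∈ {1} (s≤s (s≤s z≤n))))

  upper-half : Covers (lineSums A) (18 + 12 * k) (suc (2 * (1 + 3 * k)))
  upper-half = covers-interleave (1 + 3 * k) rows columns
    where
    rows : ∀ q → q ≤ 1 + 3 * k → 18 + 12 * k + 2 * q ∈ lineSums A
    rows q q≤ = subst (_∈ lineSums A) (begin
      v₁ (5 + 3 * k + q) + v₂ (5 + 3 * k + q) ≡⟨ cong₂ _+_ (v₁-high _ q refl) (v₂-high _ q refl) ⟩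
      12 + 9 * k + q + (6 + 3 * k + q)  ≡⟨ solve (k ∷ q ∷ []) ⟩
      18 + 12 * k + 2 * q               ∎) (rowSum∈ (high<n (s≤s q≤)))
    columns : ∀ q → q < 1 + 3 * k → 18 + 12 * k + suc (2 * q) ∈ lineSums A
    columns q q< = subst (_∈ lineSums A) (begin
      v₁ (suc (5 + 3 * k + q)) + v₂ (5 + 3 * k + q)
        ≡⟨ cong₂ _+_ (v₁-high _ (suc q) (sym (+-suc (5 + 3 * k) q))) (v₂-high _ q refl) ⟩
      12 + 9 * k + suc q + (6 + 3 * k + q) ≡⟨ solve (k ∷ q ∷ []) ⟩
      18 + 12 * k + suc (2 * q)         ∎) (colSum∈ (+-<-witness (6 + 3 * k) 0 {7 + 6 * k} q< (solve (k ∷ []))))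

  first-column∈ : Covers (lineSums A) (21 + 18 * k) 1
  first-column∈ = covers-single (subst (_∈ lineSums A) (begin
    v₁ 0 + v₂ (6 + 6 * k)             ≡⟨ cong₂ _+_ v₁-zero (v₂-high (6 + 6 * k) (1 + 3 * k) (solve (k ∷ []))) ⟩
    14 + 12 * k + (6 + 3 * k + (1 + 3 * k)) ≡⟨ solve (k ∷ []) ⟩
    21 + 18 * k                       ∎) (colSum∈ {0} (s≤s z≤n)))

  first-row∈ : Covers (lineSums A) (22 + 18 * k) 1
  first-row∈ = covers-single (subst (_∈ lineSums A) (begin
    v₁ 0 + v₂ 0                       ≡⟨ cong₂ _+_ v₁-zero v₂-zero ⟩
    14 + 12 * k + (8 + 6 * k)         ≡⟨ solve (k ∷ []) ⟩
    22 + 18 * k                       ∎) (rowSum∈ {0} (s≤s z≤n)))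

  lines : Covers (lineSums A) (7 + 6 * k) (2 * (7 + 6 * k) + 2)
  lines = subst (Covers (lineSums A) (7 + 6 * k)) total
    (covers-++ left∈ (covers-++ middle-column∈ (covers-++ middle-row∈ (covers-++ lower-half
      (covers-++ right∈ (covers-++ high-column∈ (covers-++ second-column∈ (covers-++ upper-half
        (covers-++ first-column∈ first-row∈
        (solve (k ∷ []))) (solve (k ∷ []))) (solve (k ∷ []))) (solve (k ∷ []))) (solve (k ∷ [])))
        (solve (k ∷ []))) (solve (k ∷ []))) (solve (k ∷ []))) (solve (k ∷ [])))
    where
    total : 1 + (1 + (1 + (suc (2 * (2 + 3 * k)) + (1 + (1 + (1 + (suc (2 * (1 + 3 * k)) + (1 + 1))))))))
            ≡ 2 * (7 + 6 * k) + 2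
    total = solve (k ∷ [])

  regular : RegularSAMS (7 + 6 * k) 2
  regular = regularSAMS (proj₂ left) (proj₂ right) lines

theorem2p1 : (n : ℕ) → 5 ≤ n → (n % 6 ≡ 1 ⊎ n % 6 ≡ 5) → RegularSAMS n 2
theorem2p1 n _ (inj₂ n%6≡5) =
  subst (λ m → RegularSAMS m 2) (sym (%-residue {n} {6} n%6≡5)) (Order5Mod6.regular (n / 6))
theorem2p1 n 5≤n (inj₁ n%6≡1) with n / 6 | %-residue {n} {6} n%6≡1
... | zero  | refl = ⊥-elim (<⇒≱ (s≤s (s≤s z≤n)) 5≤n)
... | suc k | refl = subst (λ m → RegularSAMS m 2) (regroup k) (Order1Mod6.regular k)
  where
  regroup : ∀ k → 7 + 6 * k ≡ 1 + 6 * suc k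
  regroup k = solve (k ∷ [])
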